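{- Let $R$ be a directed graph with vertex set $T$ and let $H$ be a directed graph with $T\subseteq V(H)$ that is an inclusion-minimal solution to $R$. Let $P=(p_1,\ldots,p_r)$ be a $T$-avoiding directed path in $H$ between two terminals. Let $p_i,p_j,p_k$ be three vertices on $P$ such that (1) $i<j<k$, (2) there is a directed path $Q$ in $H$ from $p_k$ to $p_i$ that avoids $p_j$, and (3) every directed path $P'$ in $H$ from some terminal $s'$ to $p_j$ intersects $P$ in a vertex $p_\ell$ with $p_\ell\ne p_j$ and $\ell\le k$. Then $p_j$ has no in-neighbor in $H$ other than $p_{j-1}$.
   Context: $H$ is a solution to $R$ if for every arc $st\in A(R)$ there is a directed path from $s$ to $t$ in $H$; it is an inclusion-minimal solution if moreover for every arc $e\in A(H)$, $H-e$ is not a solution. A path is $T$-avoiding if none of its internal vertices lies in $T$. -}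

module Defs where

open import Data.Nat using (ℕ; suc; _<_; _≤_)
open import Data.Fin using (Fin; toℕ)
open import Data.List using (List; length; lookup; head; last)
open import Data.List.Relation.Unary.Linked using (Linked)
open import Data.List.Relation.Unary.Unique.Propositional using (Unique)
open import Data.List.Membership.Propositional using (_∈_; _∉_)
open import Data.Maybe using (just)
open import Data.Product using (Σ; ∃; _×_)
open import Relation.Nullary using (¬_)
open import Relation.Binary.PropositionalEquality using (_≡_; _≢_)

Digraph : ℕ → Set₁
Digraph n = Fin n → Fin n → Set

removeArc : ∀ {n} → Digraph n → Fin n → Fin n → Digraph n
removeArc A u v x y = A x y × ¬ (x ≡ u × y ≡ v)

IsPath : ∀ {n} → Digraph n → List (Fin n) → Set
IsPath A ps = Unique ps × Linked A ps

PathFromTo : ∀ {n} → Digraph n → Fin n → Fin n → List (Fin n) → Set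
PathFromTo A s t ps = IsPath A ps × head ps ≡ just s × last ps ≡ just t

-- Terminals: the vertex set T of R (= Fin m) embedded into V(H) = Fin n by τ.
IsTerminal : ∀ {m n} → (Fin m → Fin n) → Fin n → Set
IsTerminal {m} τ v = Σ (Fin m) (λ a → τ a ≡ v)

IsSolution : ∀ {m n} → (τ : Fin m → Fin n) → Digraph m → Digraph n → Set
IsSolution τ R A = ∀ a b → R a b → ∃ (λ ps → PathFromTo A (τ a) (τ b) ps)

IsMinimalSolution : ∀ {m n} → (τ : Fin m → Fin n) → Digraph m → Digraph n → Set
IsMinimalSolution τ R A =
  IsSolution τ R A × (∀ u v → A u v → ¬ IsSolution τ R (removeArc A u v))

TAvoiding : ∀ {m n} → (Fin m → Fin n) → List (Fin n) → Set
TAvoiding τ ps = ∀ (x : Fin (length ps)) → 0 < toℕ x → suc (toℕ x) < length ps →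
  ¬ IsTerminal τ (lookup ps x)

module Submission where

-- Let w = p_j and suppose H has an arc v → w with v ≠ p_{j-1}.  We show that
-- B = H − vw is still a solution, contradicting minimality.
--   * All arcs of P survive in B: the only arc of P entering w is p_{j-1} → w.  Hence in B
--     every p_l reaches every later p_l' along P, and every p_l with l ≤ k, l ≠ j reaches w:
--     directly along P when l < j, and along P to p_k, back to p_i by Q (which avoids w),
--     and along P to w when l > j.
--   * Bypass lemma (for an arbitrary digraph and arc vw): if every H-path from s to w meets
--     a vertex y ≠ w that reaches w in B, then everything reachable from s by an H-path is
--     reachable from s in B.  Split such a path at w: its part before w avoids w, hence
--     uses no arc into w, the detour y ⇝ w re-enters w, and the part after w avoids w too.
--   * Hypothesis (3) provides exactly these detours for every terminal source, and walks of B
--     shorten to paths, so B is a solution.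

open import Defs
open import Data.Nat using (suc; _<_; _≤_; z≤n; s≤s)
open import Data.Nat.Properties using (suc-injective; <-cmp; <⇒≤; ≤-<-trans)
open import Data.Fin using (Fin; toℕ)
import Data.Fin as F
open import Data.Fin.Properties using (toℕ-injective; toℕ-inject₁)
open import Data.List using (List; []; _∷_; _++_; length; lookup; head; last)
open import Data.List.Properties using (++-assoc)
open import Data.List.Relation.Unary.Linked as Linked using (Linked; []; [-]; _∷_)
open import Data.List.Relation.Unary.Unique.Propositional using (Unique)
open import Data.List.Relation.Unary.Unique.Propositional.Properties using (Unique[x∷xs]⇒x∉xs)
open import Data.List.Relation.Unary.AllPairs using ([]; _∷_)
open import Data.List.Relation.Unary.All using ([]; _∷_)
open import Data.List.Relation.Unary.All.Properties using (++⁻ˡ; ¬Any⇒All¬)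
open import Data.List.Relation.Unary.Any using (here; there; any?)
open import Data.List.Membership.Propositional using (_∈_; _∉_)
open import Data.List.Membership.Propositional.Properties using (∈-lookup; ∈-++⁺ʳ; ∈-++⁻; ∈-∃++)
open import Data.Maybe using (just)
open import Data.Product using (Σ; ∃; _×_; _,_; proj₁; proj₂)
open import Data.Sum using (inj₁; inj₂)
open import Data.Empty using (⊥-elim)
open import Function using (_∘_)
open import Relation.Nullary using (yes; no; ¬_)
open import Relation.Binary.Definitions using (tri<; tri≈; tri>)
open import Relation.Binary.PropositionalEquality using (_≡_; _≢_; refl; sym; trans; cong; subst)
open import Relation.Binary.Construct.Closure.ReflexiveTransitive using (Star; ε; _◅_; _◅◅_)

private
  variable
    A : Set
    R : A → A → Set
    x y : A
    xs ys : List A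

predecessor : ∀ {m} (j : Fin m) → 0 < toℕ j → Σ (Fin m) (λ j′ → suc (toℕ j′) ≡ toℕ j)
predecessor (F.suc j) _ = F.inject₁ j , cong suc (toℕ-inject₁ j)

lookup-injective : Unique xs → (a b : Fin (length xs)) → lookup xs a ≡ lookup xs b → a ≡ b
lookup-injective (_ ∷ _) F.zero F.zero _ = refl
lookup-injective u@(_ ∷ _) F.zero (F.suc b) eq =
  ⊥-elim (Unique[x∷xs]⇒x∉xs u (subst (_∈ _) (sym eq) (∈-lookup b)))
lookup-injective u@(_ ∷ _) (F.suc a) F.zero eq =
  ⊥-elim (Unique[x∷xs]⇒x∉xs u (subst (_∈ _) eq (∈-lookup a)))
lookup-injective (_ ∷ u) (F.suc a) (F.suc b) eq = cong F.suc (lookup-injective u a b eq)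

linked-lookup : Linked R xs → (a b : Fin (length xs)) → suc (toℕ a) ≡ toℕ b →
  R (lookup xs a) (lookup xs b)
linked-lookup (r ∷ _) F.zero (F.suc F.zero) refl = r
linked-lookup (_ ∷ l) (F.suc a) (F.suc b) a↦b = linked-lookup l a b (suc-injective a↦b)
linked-lookup [-] F.zero F.zero ()
linked-lookup [-] (F.suc ()) _ _

walkAlong : (xs : List A) → (∀ a b → suc (toℕ a) ≡ toℕ b → R (lookup xs a) (lookup xs b)) →
  (a b : Fin (length xs)) → toℕ a ≤ toℕ b → Star R (lookup xs a) (lookup xs b)
walkAlong (_ ∷ _) arcs F.zero F.zero _ = ε
walkAlong (_ ∷ y ∷ xs) arcs F.zero (F.suc b) _ =
  arcs F.zero (F.suc F.zero) refl ◅ walkAlong (y ∷ xs) (λ a b → arcs (F.suc a) (F.suc b) ∘ cong suc) F.zero b z≤n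
walkAlong (_ ∷ xs) arcs (F.suc a) (F.suc b) (s≤s a≤b) =
  walkAlong xs (λ a b → arcs (F.suc a) (F.suc b) ∘ cong suc) a b a≤b

walkTo : Linked R (x ∷ xs) → y ∈ x ∷ xs → Star R x y
walkTo _ (here refl) = ε
walkTo (r ∷ l) (there y∈xs) = r ◅ walkTo l y∈xs

last-∈ : last xs ≡ just y → y ∈ xs
last-∈ {xs = _ ∷ []} refl = here refl
last-∈ {xs = _ ∷ _ ∷ _} eq = there (last-∈ eq)

head-++-∷ : ∀ xs {zs} → head (xs ++ y ∷ ys) ≡ head (xs ++ y ∷ zs)
head-++-∷ [] = refl
head-++-∷ (_ ∷ _) = refl

last-++-∷ : ∀ xs → last (xs ++ y ∷ ys) ≡ last (y ∷ ys)
last-++-∷ [] = refl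
last-++-∷ (_ ∷ []) = refl
last-++-∷ (_ ∷ x ∷ xs) = last-++-∷ (x ∷ xs)

linked-prefix : ∀ xs → Linked R (xs ++ ys) → Linked R xs
linked-prefix [] _ = []
linked-prefix (_ ∷ []) _ = [-]
linked-prefix (_ ∷ x ∷ xs) (r ∷ l) = r ∷ linked-prefix (x ∷ xs) l

linked-suffix : ∀ xs → Linked R (xs ++ ys) → Linked R ys
linked-suffix [] l = l
linked-suffix (_ ∷ xs) l = linked-suffix xs (Linked.tail l)

unique-prefix : ∀ xs → Unique (xs ++ ys) → Unique xs
unique-prefix [] _ = []
unique-prefix (_ ∷ xs) (x∉ ∷ u) = ++⁻ˡ xs x∉ ∷ unique-prefix xs u

unique-suffix : ∀ xs → Unique (xs ++ ys) → Unique ys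
unique-suffix [] u = u
unique-suffix (_ ∷ xs) (_ ∷ u) = unique-suffix xs u

unique-∉-prefix : ∀ xs → Unique (xs ++ y ∷ ys) → y ∉ xs
unique-∉-prefix (_ ∷ xs) u (here refl) = Unique[x∷xs]⇒x∉xs u (∈-++⁺ʳ xs (here refl))
unique-∉-prefix (_ ∷ xs) (_ ∷ u) (there y∈xs) = unique-∉-prefix xs u y∈xs

pathPrefix : ∀ {n} {R : Digraph n} {s t x : Fin n} pre {post} →
  PathFromTo R s t (pre ++ x ∷ post) → PathFromTo R s x (pre ++ x ∷ [])
pathPrefix {x = x} pre {post} ((u , l) , hd , _) =
  (unique-prefix (pre ++ x ∷ []) (subst Unique split u) ,
   linked-prefix (pre ++ x ∷ []) (subst (Linked _) split l)) ,
  trans (head-++-∷ pre) hd , last-++-∷ pre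
  where
  split : pre ++ x ∷ post ≡ (pre ++ x ∷ []) ++ post
  split = sym (++-assoc pre (x ∷ []) post)

pathSuffix : ∀ {n} {R : Digraph n} {s t x : Fin n} pre {post} →
  PathFromTo R s t (pre ++ x ∷ post) → PathFromTo R x t (x ∷ post)
pathSuffix pre ((u , l) , _ , la) =
  (unique-suffix pre u , linked-suffix pre l) , refl , trans (sym (last-++-∷ pre)) la

-- Every walk can be shortened to a path with the same ends: when the walk returns to its
-- start, continue with the path from that later visit onward.
walk⇒path : ∀ {n} {R : Digraph n} {x y : Fin n} → Star R x y → ∃ (λ ps → PathFromTo R x y ps)
walk⇒path {x = x} ε = x ∷ [] , ([] ∷ [] , [-]) , refl , refl
walk⇒path {R = R} {x} {y} (r ◅ walk) with walk⇒path walk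
... | z ∷ zs , (u , l) , refl , la with any? (x F.≟_) (z ∷ zs)
...   | no x∉ = x ∷ z ∷ zs , (¬Any⇒All¬ (z ∷ zs) x∉ ∷ u , r ∷ l) , refl , la
...   | yes x∈ with ∈-∃++ x∈
...     | pre , post , eq =
  x ∷ post , pathSuffix pre (subst (PathFromTo R z y) eq ((u , l) , refl , la))

module WithoutArc {n} (H : Digraph n) (v w : Fin n) where

  B : Digraph n
  B = removeArc H v w

  -- An H-path that does not return to w (it may start there) uses no arc into w, so it
  -- survives in B; hence B reaches each of its vertices from its start.
  reachAvoiding : ∀ {x y xs} → Linked H (x ∷ xs) → w ∉ xs → y ∈ x ∷ xs → Star B x y
  reachAvoiding l w∉xs = walkTo (survives l w∉xs)
    where
    survives : ∀ {x xs} → Linked H (x ∷ xs) → w ∉ xs → Linked B (x ∷ xs)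
    survives [-] _ = [-]
    survives (h ∷ l) w∉xs = (h , λ (_ , y≡w) → w∉xs (here (sym y≡w))) ∷ survives l (w∉xs ∘ there)

  pathAvoiding : ∀ {x y ps} → PathFromTo H x y ps → w ∉ ps → Star B x y
  pathAvoiding {ps = _ ∷ _} ((_ , l) , refl , la) w∉ps = reachAvoiding l (w∉ps ∘ there) (last-∈ la)

  Detour : Fin n → Set
  Detour s = ∀ P′ → PathFromTo H s w P′ → ∃ (λ y → y ∈ P′ × y ≢ w × Star B y w)

  -- A path through w is cut at w: the part before w avoids w, the detour re-enters w, and
  -- the part after w avoids w again.
  bypass : ∀ {s t} ps → Detour s → PathFromTo H s t ps → Star B s t
  bypass ps detour path with any? (w F.≟_) ps
  ... | no w∉ps = pathAvoiding path w∉ps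
  ... | yes w∈ps with ∈-∃++ w∈ps
  ...   | pre , post , refl with detour (pre ++ w ∷ []) (pathPrefix pre path)
  ...     | y , y∈ , y≢w , y⇝w = beforeW pre path y∈pre ◅◅ y⇝w ◅◅ afterW (pathSuffix pre path)
    where
    y∈pre : y ∈ pre
    y∈pre with ∈-++⁻ pre y∈
    ... | inj₁ y∈pre = y∈pre
    ... | inj₂ (here y≡w) = ⊥-elim (y≢w y≡w)
    beforeW : ∀ {s t y} pre {post} → PathFromTo H s t (pre ++ w ∷ post) → y ∈ pre → Star B s y
    beforeW (_ ∷ pre) ((u , l) , refl , _) =
      reachAvoiding (linked-prefix (_ ∷ pre) l) (unique-∉-prefix (_ ∷ pre) u ∘ there)
    afterW : ∀ {t post} → PathFromTo H w t (w ∷ post) → Star B w t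
    afterW ((u , l) , _ , la) = reachAvoiding l (Unique[x∷xs]⇒x∉xs u) (last-∈ la)

  solutionWithoutArc : ∀ {m} {τ : Fin m → Fin n} {R : Digraph m} →
    IsSolution τ R H → (∀ a → Detour (τ a)) → IsSolution τ R B
  solutionWithoutArc sol detour a b Rab =
    let ps , path = sol a b Rab in walk⇒path (bypass ps (detour a) path)

module Rerouting {n} (H : Digraph n) (P : List (Fin n)) (pathP : IsPath H P) (v : Fin n)
  (j′ j : Fin (length P)) (j′↦j : suc (toℕ j′) ≡ toℕ j) (v≢pj′ : v ≢ lookup P j′) where

  open WithoutArc H v (lookup P j)

  -- The only arc of P entering p_j comes from p_{j-1} ≠ v, so every arc of P survives in B.
  arcsSurvive : ∀ a b → suc (toℕ a) ≡ toℕ b → B (lookup P a) (lookup P b)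
  arcsSurvive a b a↦b = linked-lookup (proj₂ pathP) a b a↦b , notDeleted
    where
    notDeleted : ¬ (lookup P a ≡ v × lookup P b ≡ lookup P j)
    notDeleted (pa≡v , pb≡pj) = v≢pj′ (trans (sym pa≡v) (cong (lookup P) a≡j′))
      where
      b≡j : b ≡ j
      b≡j = lookup-injective (proj₁ pathP) b j pb≡pj
      a≡j′ : a ≡ j′
      a≡j′ = toℕ-injective (suc-injective (trans a↦b (trans (cong toℕ b≡j) (sym j′↦j))))

  alongP : ∀ a b → toℕ a ≤ toℕ b → Star B (lookup P a) (lookup P b)
  alongP = walkAlong P arcsSurvive

  reachPj : ∀ i k → toℕ i < toℕ j → Star B (lookup P k) (lookup P i) →
    ∀ l → lookup P l ≢ lookup P j → toℕ l ≤ toℕ k → Star B (lookup P l) (lookup P j)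
  reachPj i k i<j pk⇝pi l pl≢pj l≤k with <-cmp (toℕ l) (toℕ j)
  ... | tri< l<j _ _ = alongP l j (<⇒≤ l<j)
  ... | tri≈ _ l≡j _ = ⊥-elim (pl≢pj (cong (lookup P) (toℕ-injective l≡j)))
  ... | tri> _ _ _ = alongP l k l≤k ◅◅ pk⇝pi ◅◅ alongP i j (<⇒≤ i<j)

-- Otherwise the arc v → p_j could
-- be deleted: hypothesis (3) yields the detours required by the bypass lemma, using the walk
-- along Q, which avoids p_j.
mainTheorem6 : ∀ {m n} (τ : Fin m → Fin n) → (∀ a b → τ a ≡ τ b → a ≡ b) →
    (R : Digraph m) (H : Digraph n) → IsMinimalSolution τ R H →
    (P : List (Fin n)) (s t : Fin n) → IsTerminal τ s → IsTerminal τ t →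
    PathFromTo H s t P → TAvoiding τ P →
    (i j k : Fin (length P)) → toℕ i < toℕ j → toℕ j < toℕ k →
    ∃ (λ Q → PathFromTo H (lookup P k) (lookup P i) Q × lookup P j ∉ Q) →
    (∀ (s′ : Fin n) → IsTerminal τ s′ → (P′ : List (Fin n)) →
      PathFromTo H s′ (lookup P j) P′ →
      Σ (Fin (length P)) (λ l → lookup P l ∈ P′ × lookup P l ≢ lookup P j × toℕ l ≤ toℕ k)) →
    ∀ (v : Fin n) → H v (lookup P j) →
      Σ (Fin (length P)) (λ j′ → suc (toℕ j′) ≡ toℕ j × v ≡ lookup P j′)
mainTheorem6 τ _ R H (solution , minimal) P _ _ _ _ (pathP , _) _ i j k i<j _
  (Q , pathQ , pj∉Q) meetsP v v→pj
  with predecessor j (≤-<-trans z≤n i<j)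
... | j′ , j′↦j with v F.≟ lookup P j′
...   | yes v≡pj′ = j′ , j′↦j , v≡pj′
...   | no v≢pj′ = ⊥-elim (minimal v (lookup P j) v→pj (solutionWithoutArc solution detour))
  where
  open WithoutArc H v (lookup P j)
  open Rerouting H P pathP v j′ j j′↦j v≢pj′
  detour : ∀ a → Detour (τ a)
  detour a P′ pathP′ with meetsP (τ a) (a , refl) P′ pathP′
  ... | l , pl∈P′ , pl≢pj , l≤k =
    lookup P l , pl∈P′ , pl≢pj , reachPj i k i<j (pathAvoiding pathQ pj∉Q) l pl≢pj l≤k
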